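{- Let $\mathcal G$ be a finite abelian group and let $T$ be a tree with fewer than $|\mathcal G|$ vertices. Then $T$ is not zero-forcing for $\mathcal G$.
   Context: For a finite abelian group $(\mathcal G,+,0)$, a $\mathcal G$-labeling of a graph $G$ is a map $\ell: V(G)\to\mathcal G$, extended to vertex sets by $\ell(A)=\sum_{x\in A}\ell(x)$. A set $A\subseteq V(G)$ is called connected if $G[A]$ is connected. $(G,\ell)$ is zero-avoiding if $\ell(A)\neq 0$ for every non-empty connected $A\subseteq V(G)$. $G$ is zero-forcing for $\mathcal G$ if there is no $\mathcal G$-labeling $\ell$ of $G$ with $(G,\ell)$ zero-avoiding. -}

module Defs where

open import Level using (Level; _⊔_)
open import Data.Nat using (ℕ; zero; suc; _≤_)
open import Data.Fin using (Fin; zero; suc; inject₁; fromℕ)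
open import Data.Bool using (Bool; true; false; if_then_else_)
open import Data.Product using (Σ; ∃; _×_; _,_)
open import Relation.Binary.PropositionalEquality using (_≡_)
open import Relation.Nullary using (¬_)
open import Algebra.Bundles using (AbelianGroup)

record FiniteAbelianGroup (c ℓ : Level) : Set (Level.suc (c ⊔ ℓ)) where
  field
    abGroup     : AbelianGroup c ℓ
  open AbelianGroup abGroup public
  field
    order       : ℕ
    enum        : Fin order → Carrier
    enum-inj    : ∀ i j → enum i ≈ enum j → i ≡ j
    enum-surj   : ∀ g → ∃ λ i → enum i ≈ g

record Graph (n : ℕ) : Set where
  field
    adj     : Fin n → Fin n → Bool
    sym     : ∀ x y → adj x y ≡ adj y x
    irrefl  : ∀ x → adj x x ≡ false

module _ {n : ℕ} (G : Graph n) where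
  open Graph G

  Edge : Fin n → Fin n → Set
  Edge x y = adj x y ≡ true

  VSet : Set
  VSet = Fin n → Bool

  data WalkIn (A : VSet) : Fin n → Fin n → Set where
    here : ∀ {x} → A x ≡ true → WalkIn A x x
    step : ∀ {x y z} → A x ≡ true → Edge x y → WalkIn A y z → WalkIn A x z

  ConnectedSet : VSet → Set
  ConnectedSet A = ∀ x y → A x ≡ true → A y ≡ true → WalkIn A x y

  NonEmpty : VSet → Set
  NonEmpty A = ∃ λ x → A x ≡ true

  IsConnected : Set
  IsConnected = NonEmpty (λ _ → true) × ConnectedSet (λ _ → true)

  -- a cycle: k+1 ≥ 3 pairwise distinct vertices v₀ … v_k with
  -- v_i ~ v_{i+1} and v_k ~ v₀
  record Cycle : Set where
    field
      k      : ℕ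
      len≥3  : 2 ≤ k
      v      : Fin (suc k) → Fin n
      v-inj  : ∀ i j → v i ≡ v j → i ≡ j
      edges  : ∀ (i : Fin k) → Edge (v (inject₁ i)) (v (suc i))
      close  : Edge (v (fromℕ k)) (v zero)

  IsAcyclic : Set
  IsAcyclic = ¬ Cycle

  IsTree : Set
  IsTree = IsConnected × IsAcyclic

module _ {c ℓ : Level} (𝒢 : FiniteAbelianGroup c ℓ) where
  open FiniteAbelianGroup 𝒢

  labelSum : ∀ {n} → (Fin n → Bool) → (Fin n → Carrier) → Carrier
  labelSum {zero}  A lab = ε
  labelSum {suc n} A lab =
    (if A zero then lab zero else ε) ∙ labelSum (λ i → A (suc i)) (λ i → lab (suc i))

  ZeroAvoiding : ∀ {n} → Graph n → (Fin n → Carrier) → Set ℓ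
  ZeroAvoiding G lab =
    ∀ (A : Fin _ → Bool) → NonEmpty G A → ConnectedSet G A → ¬ (labelSum A lab ≈ ε)

  ZeroForcing : ∀ {n} → Graph n → Set (c ⊔ ℓ)
  ZeroForcing G = ¬ (Σ (Fin _ → Carrier) λ lab → ZeroAvoiding G lab)

-- Root the tree and let s(v) be the number of vertices of the subtree below v.  A finite abelian
-- group has a subgroup K with a bijection rank : K → {0, …, N - 1}, N > n, satisfying rank 0 = 0 and
-- rank (x + y) ≤ rank x + rank y: adjoining an element g ∉ K to a ranked subgroup, every element of
-- K + ⟨g⟩ is k + d·g with k ∈ K and 0 ≤ d < q (q the order of g modulo K), and d·N + rank k ranks it
-- subadditively, a carry in the digit d costing at most rank (q·g) < N.
-- Let y(v) be the element of rank s(v) and label v by y(v) minus the sum of y over the children of v.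
-- On a connected set A with top vertex r the labels telescope to y(r) - Σ y(c), the sum over the
-- vertices c ∉ A whose parent lies in A.  Their subtrees are disjoint and lie strictly below r, so
-- Σ s(c) < s(r); by subadditivity rank (Σ y(c)) ≤ Σ s(c) < rank y(r), so the label sum is not 0.

module Submission where

open import Defs
open import Level using (Level)
open import Data.Nat using (ℕ; _<_)
open import Relation.Nullary using (¬_)

open import Algebra.Bundles using (CommutativeMonoid)
open import Algebra.Core using (Op₁; Op₂)
open import Algebra.Structures using (IsAbelianGroup)
open import Data.Fin using (Fin)
open import Data.Product using (Σ; _,_)
open import Function using (_∘_)
open import Relation.Binary.PropositionalEquality using (_≡_)

module LeastSearch where
  open import Data.Nat using (ℕ; zero; suc; _<_; _≤_; _<?_)
  open import Data.Nat.Properties using (m<n⇒m<1+n; n<1+n; m<1+n⇒m<n∨m≡n; ≮⇒≥)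
  open import Data.Product using (∃; _×_; _,_)
  open import Data.Sum using (_⊎_; inj₁; inj₂; [_,_])
  open import Relation.Nullary using (¬_; yes; no; contradiction)
  open import Relation.Unary using (Pred; Decidable)
  open import Relation.Binary.PropositionalEquality using (refl)

  module _ {p} {P : Pred ℕ p} (P? : Decidable P) where

    Least : ℕ → Set p
    Least d = P d × (∀ {d′} → d′ < d → ¬ P d′)

    least-below : ∀ b → (∃ λ d → d < b × Least d) ⊎ (∀ {d} → d < b → ¬ P d)
    least-below zero = inj₂ λ ()
    least-below (suc b) with least-below b
    ... | inj₁ (d , d<b , d-least) = inj₁ (d , m<n⇒m<1+n d<b , d-least)
    ... | inj₂ none with P? b
    ...   | yes pb = inj₁ (b , n<1+n b , pb , none)
    ...   | no ¬pb = inj₂ λ d<1+b → [ none , (λ { refl → ¬pb }) ] (m<1+n⇒m<n∨m≡n d<1+b)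

    least : ∀ {b} → P b → ∃ Least
    least {b} pb with least-below (suc b)
    ... | inj₁ (d , _ , l) = d , l
    ... | inj₂ none = contradiction pb (none (n<1+n b))

    least-≤ : ∀ {d b} → Least d → P b → d ≤ b
    least-≤ {d} {b} (_ , below) pb with b <? d
    ... | yes b<d = contradiction pb (below b<d)
    ... | no  b≮d = ≮⇒≥ b≮d

module FilteredSum {a ℓ} (M : CommutativeMonoid a ℓ) where
  open import Data.Fin using (Fin; punchIn; _≟_)
  open import Data.Fin.Properties using (punchInᵢ≢i)
  open import Data.Nat using (ℕ; suc)
  open import Data.Product using (_×_; _,_; proj₂)
  open import Data.Sum using (_⊎_; inj₁; inj₂)
  open import Data.Vec.Functional using (Vector)
  open import Function using (_∘_; _⇔_; Equivalence; mk⇔)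
  open import Level using (Level)
  open import Relation.Binary.PropositionalEquality as ≡ using (_≡_; _≢_)
  open import Relation.Nullary using (Dec; yes; no; ¬_; ¬?; contradiction)
  open import Relation.Nullary.Decidable using (_×-dec_)
  open import Relation.Unary using (Pred; Decidable)

  open CommutativeMonoid M renaming (_∙_ to _+_; ε to 0#; ∙-congˡ to +-congˡ; ∙-congʳ to +-congʳ)
  open import Algebra.Properties.CommutativeMonoid.Sum M public
  open import Relation.Binary.Reasoning.Setoid setoid

  private
    variable
      p q r : Level
      n k : ℕ
      A B C : Set p

  select : Dec A → Carrier → Carrier
  select (yes _) x = x
  select (no  _) x = 0#

  ∑⟨_⟩ : {P : Pred (Fin n) p} → Decidable P → Vector Carrier n → Carrier
  ∑⟨ P? ⟩ f = sum (λ i → select (P? i) (f i))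

  select-yes : (A? : Dec A) → A → ∀ x → select A? x ≈ x
  select-yes (yes _) _ x = refl
  select-yes (no ¬a) a x = contradiction a ¬a

  select-⇔ : (A? : Dec A) (B? : Dec B) → A ⇔ B → ∀ x → select A? x ≈ select B? x
  select-⇔ (yes _) (yes _) _   x = refl
  select-⇔ (no  _) (no  _) _   x = refl
  select-⇔ (yes a) (no ¬b) A⇔B x = contradiction (Equivalence.to A⇔B a) ¬b
  select-⇔ (no ¬a) (yes b) A⇔B x = contradiction (Equivalence.from A⇔B b) ¬a

  select-⊎ : (A? : Dec A) (B? : Dec B) (C? : Dec C) → A ⇔ (B ⊎ C) → (B → ¬ C) →
             ∀ x → select A? x ≈ select B? x + select C? x
  select-⊎ _       (yes b) (yes c) _   B∩C=∅ x = contradiction c (B∩C=∅ b)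
  select-⊎ (yes _) (yes _) (no  _) _   _     x = sym (identityʳ x)
  select-⊎ (yes _) (no  _) (yes _) _   _     x = sym (identityˡ x)
  select-⊎ (no  _) (no  _) (no  _) _   _     x = sym (identityˡ 0#)
  select-⊎ (yes a) (no ¬b) (no ¬c) A⇔B⊎C _ x with Equivalence.to A⇔B⊎C a
  ... | inj₁ b = contradiction b ¬b
  ... | inj₂ c = contradiction c ¬c
  select-⊎ (no ¬a) (yes b) _       A⇔B⊎C _ x = contradiction (Equivalence.from A⇔B⊎C (inj₁ b)) ¬a
  select-⊎ (no ¬a) _       (yes c) A⇔B⊎C _ x = contradiction (Equivalence.from A⇔B⊎C (inj₂ c)) ¬a

  ∑⟨⟩-cong : {P : Pred (Fin n) p} (P? : Decidable P) {f g : Vector Carrier n} →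
             (∀ i → P i → f i ≈ g i) → ∑⟨ P? ⟩ f ≈ ∑⟨ P? ⟩ g
  ∑⟨⟩-cong P? f≈g = sum-cong-≋ λ i → pointwise (P? i) (f≈g i)
    where
    pointwise : ∀ {x y} (A? : Dec A) → (A → x ≈ y) → select A? x ≈ select A? y
    pointwise (yes a) x≈y = x≈y a
    pointwise (no  _) _   = refl

  ∑⟨⟩-distrib : {P : Pred (Fin n) p} (P? : Decidable P) (f g : Vector Carrier n) →
                ∑⟨ P? ⟩ (λ i → f i + g i) ≈ ∑⟨ P? ⟩ f + ∑⟨ P? ⟩ g
  ∑⟨⟩-distrib P? f g =
    trans (sum-cong-≋ λ i → pointwise (P? i)) (∑-distrib-+ (λ i → select (P? i) (f i)) (λ i → select (P? i) (g i)))
    where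
    pointwise : ∀ {x y} (A? : Dec A) → select A? (x + y) ≈ select A? x + select A? y
    pointwise (yes _) = refl
    pointwise (no  _) = sym (identityˡ 0#)

  ∑⟨⟩-none : {P : Pred (Fin n) p} (P? : Decidable P) (f : Vector Carrier n) → (∀ i → ¬ P i) → ∑⟨ P? ⟩ f ≈ 0#
  ∑⟨⟩-none {n = n} P? f none = trans (sum-cong-≋ λ i → pointwise (P? i) (none i)) (sum-replicate-zero n)
    where
    pointwise : ∀ {x} (A? : Dec A) → ¬ A → select A? x ≈ 0#
    pointwise (yes a) ¬a = contradiction a ¬a
    pointwise (no  _) _  = refl

  ∑⟨⟩-subsingleton : {P : Pred (Fin n) p} (P? : Decidable P) (f : Vector Carrier n) (w : Fin n) →
                     (∀ i → P i → i ≡ w) → ∑⟨ P? ⟩ f ≈ select (P? w) (f w)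
  ∑⟨⟩-subsingleton {n = suc n} P? f w only-w = begin
    ∑⟨ P? ⟩ f                                                   ≈⟨ sum-remove {i = w} (λ i → select (P? i) (f i)) ⟩
    select (P? w) (f w) + ∑⟨ P? ∘ punchIn w ⟩ (f ∘ punchIn w)   ≈⟨ +-congˡ rest≈0 ⟩
    select (P? w) (f w) + 0#                                    ≈⟨ identityʳ _ ⟩
    select (P? w) (f w)                                         ∎
    where
    rest≈0 = ∑⟨⟩-none (P? ∘ punchIn w) (f ∘ punchIn w) (λ i P[i] → punchInᵢ≢i w i (only-w _ P[i]))

  ∑⟨⟩-split : {P : Pred (Fin n) p} {Q : Pred (Fin n) q} {R : Pred (Fin n) r}
              (P? : Decidable P) (Q? : Decidable Q) (R? : Decidable R) →
              (∀ i → P i ⇔ (Q i ⊎ R i)) → (∀ i → Q i → ¬ R i) →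
              ∀ f → ∑⟨ P? ⟩ f ≈ ∑⟨ Q? ⟩ f + ∑⟨ R? ⟩ f
  ∑⟨⟩-split P? Q? R? P⇔Q⊎R Q∩R=∅ f =
    trans (sum-cong-≋ λ i → select-⊎ (P? i) (Q? i) (R? i) (P⇔Q⊎R i) (Q∩R=∅ i) (f i))
          (∑-distrib-+ (λ i → select (Q? i) (f i)) (λ i → select (R? i) (f i)))

  ∑⟨⟩-swap : {P : Pred (Fin n) p} {Q : Fin n → Pred (Fin k) q} (P? : Decidable P) (Q? : ∀ i → Decidable (Q i))
             (f : Vector Carrier k) →
             ∑⟨ P? ⟩ (λ i → ∑⟨ Q? i ⟩ f) ≈ sum (λ j → ∑⟨ (λ i → P? i ×-dec Q? i j) ⟩ (λ _ → f j))
  ∑⟨⟩-swap {k = k} P? Q? f =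
    trans (sum-cong-≋ λ i → pointwise (P? i) (Q? i)) (∑-comm (λ i j → select (P? i ×-dec Q? i j) (f j)))
    where
    pointwise : ∀ {A : Set p} {Q : Pred (Fin k) q} (A? : Dec A) (Q? : Decidable Q) →
                select A? (∑⟨ Q? ⟩ f) ≈ sum (λ j → select (A? ×-dec Q? j) (f j))
    pointwise (yes a) Q? = sum-cong-≋ λ j → select-⇔ (Q? j) (yes a ×-dec Q? j) (mk⇔ (a ,_) proj₂) (f j)
    pointwise (no ¬a) Q? = sym (∑⟨⟩-none (λ j → no ¬a ×-dec Q? j) f (λ j (a , _) → ¬a a))

  ∑⟨≡⟩ : ∀ (w : Fin n) f → ∑⟨ (_≟ w) ⟩ f ≈ f w
  ∑⟨≡⟩ w f = trans (∑⟨⟩-subsingleton (_≟ w) f w (λ _ eq → eq)) (select-yes (w ≟ w) ≡.refl (f w))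

  ∑⟨⟩-remove : {P : Pred (Fin n) p} (P? : Decidable P) {w : Fin n} → P w →
               ∀ f → ∑⟨ P? ⟩ f ≈ f w + ∑⟨ (λ i → P? i ×-dec ¬? (i ≟ w)) ⟩ f
  ∑⟨⟩-remove {P = P} P? {w} P[w] f = begin
    ∑⟨ P? ⟩ f                      ≈⟨ ∑⟨⟩-split P? (_≟ w) P∖w? P⇔≡w⊎P∖w (λ _ i≡w (_ , i≢w) → i≢w i≡w) f ⟩
    ∑⟨ (_≟ w) ⟩ f + ∑⟨ P∖w? ⟩ f    ≈⟨ +-congʳ (∑⟨≡⟩ w f) ⟩
    f w + ∑⟨ P∖w? ⟩ f              ∎
    where
    P∖w? : Decidable (λ i → P i × i ≢ w)
    P∖w? i = P? i ×-dec ¬? (i ≟ w)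

    to : ∀ {i} → P i → i ≡ w ⊎ (P i × i ≢ w)
    to {i} P[i] with i ≟ w
    ... | yes i≡w = inj₁ i≡w
    ... | no  i≢w = inj₂ (P[i] , i≢w)

    from : ∀ {i} → i ≡ w ⊎ (P i × i ≢ w) → P i
    from (inj₁ ≡.refl)     = P[w]
    from (inj₂ (P[i] , _)) = P[i]

    P⇔≡w⊎P∖w : ∀ i → P i ⇔ (i ≡ w ⊎ (P i × i ≢ w))
    P⇔≡w⊎P∖w i = mk⇔ to from

module NatSum where
  open import Data.Fin using (Fin; zero; suc)
  open import Data.Nat using (ℕ; zero; suc; _≤_; z≤n; s≤s)
  open import Data.Nat.Properties using (≤-trans; +-mono-≤; n≤1+n; +-0-commutativeMonoid)
  open import Function using (_∘_)
  open import Relation.Nullary using (yes; no)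
  open import Relation.Unary using (Pred; Decidable)

  open FilteredSum +-0-commutativeMonoid public

  ∑-mono-≤ : ∀ {k} {f g : Fin k → ℕ} → (∀ i → f i ≤ g i) → sum f ≤ sum g
  ∑-mono-≤ {zero}  _   = z≤n
  ∑-mono-≤ {suc k} f≤g = +-mono-≤ (f≤g zero) (∑-mono-≤ (f≤g ∘ suc))

  count : ∀ {k p} {P : Pred (Fin k) p} → Decidable P → ℕ
  count P? = ∑⟨ P? ⟩ (λ _ → 1)

  count≤ : ∀ {k p} {P : Pred (Fin k) p} (P? : Decidable P) → count P? ≤ k
  count≤ {zero}  P? = z≤n
  count≤ {suc k} P? with P? zero
  ... | yes _ = s≤s (count≤ (P? ∘ suc))
  ... | no  _ = ≤-trans (count≤ (P? ∘ suc)) (n≤1+n k)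

module MixedRadix where
  open import Data.Nat using (zero; suc; _+_; _*_; _<_)
  open import Data.Nat.DivMod using (_/_; _%_; m≡m%n+[m/n]*n; m%n<n; m<n*o⇒m/o<n; [m+kn]%n≡m%n; m<n⇒m%n≡m)
  open import Data.Nat.Properties
    using (+-comm; +-monoʳ-<; *-monoˡ-≤; *-zeroʳ; *-cancelʳ-≡; +-cancelʳ-≡; module ≤-Reasoning)
  open import Data.Nat.Tactic.RingSolver using (solve-∀)
  open import Data.Product using (∃₂; _×_; _,_)
  open import Relation.Binary.PropositionalEquality using (_≡_; sym; trans; cong; subst; module ≡-Reasoning)

  place-value-< : ∀ {q N d a} → d < q → a < N → d * N + a < q * N
  place-value-< {q} {N} {d} {a} d<q a<N = begin-strict
    d * N + a  <⟨ +-monoʳ-< (d * N) a<N ⟩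
    d * N + N  ≡⟨ +-comm (d * N) N ⟩
    suc d * N  ≤⟨ *-monoˡ-≤ N d<q ⟩
    q * N      ∎
    where open ≤-Reasoning

  place-value-split : ∀ q {N r} → r < q * N → ∃₂ λ d a → d < q × a < N × r ≡ d * N + a
  place-value-split q {zero} {r} r<q*0 with () ← subst (r <_) (*-zeroʳ q) r<q*0
  place-value-split q {N@(suc _)} {r} r<qN =
    r / N , r % N , m<n*o⇒m/o<n r<qN , m%n<n r N , trans (m≡m%n+[m/n]*n r N) (+-comm (r % N) _)

  place-value-injective : ∀ {N} d e {a b} → a < N → b < N → d * N + a ≡ e * N + b → d ≡ e × a ≡ b
  place-value-injective {N@(suc _)} d e {a} {b} a<N b<N eq = d≡e , a≡b
    where
    a≡b : a ≡ b
    a≡b = begin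
      a                  ≡⟨ sym (m<n⇒m%n≡m a<N) ⟩
      a % N              ≡⟨ sym ([m+kn]%n≡m%n a d N) ⟩
      (a + d * N) % N    ≡⟨ cong (_% N) (trans (+-comm a (d * N)) (trans eq (+-comm (e * N) b))) ⟩
      (b + e * N) % N    ≡⟨ [m+kn]%n≡m%n b e N ⟩
      b % N              ≡⟨ m<n⇒m%n≡m b<N ⟩
      b                  ∎
      where open ≡-Reasoning
    d≡e : d ≡ e
    d≡e = *-cancelʳ-≡ d e N (+-cancelʳ-≡ a (d * N) (e * N) (trans eq (cong (e * N +_) (sym a≡b))))

  place-value-+ : ∀ d e N a b → (d + e) * N + (a + b) ≡ (d * N + a) + (e * N + b)
  place-value-+ = solve-∀

  absorb-carry : ∀ f N c → f * N + (c + N) ≡ (1 + f) * N + c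
  absorb-carry = solve-∀

module SubadditiveRanking {m : ℕ} {mul : Op₂ (Fin m)} {ε : Fin m} {inv : Op₁ (Fin m)}
  (isAbelianGroup : IsAbelianGroup _≡_ mul ε inv) where
  open import Algebra.Bundles using (AbelianGroup)
  open import Data.Fin using (zero; suc; toℕ; fromℕ<; _≟_)
  open import Data.Vec.Functional using (Vector)
  open import Function using (_∘_)
  open import Data.Fin.Properties using (pigeonhole; injective⇒≤; toℕ-fromℕ<; any?)
  open import Data.Nat using (zero; suc; _+_; _*_; _∸_; _<_; _≤_; _<?_; z≤n; s≤s)
  open import Data.Nat.Properties
    using (anyUpTo?; <-cmp; ≤-trans; <-≤-trans; ≤-<-trans; +-suc; +-identityʳ; m≤n+m; m<m+n; ≮⇒≥; <⇒≤;
           +-monoʳ-≤; +-monoˡ-≤; +-mono-≤; +-mono-<; +-cancelˡ-<; *-monoˡ-≤; n<1+n; m+[n∸m]≡n; m∸n≤m;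
           m<n⇒0<n∸m; ∸-monoʳ-<; ≤-reflexive; +-0-commutativeMonoid; module ≤-Reasoning)
  open import Relation.Nullary.Decidable using (decidable-stable)
  open import Data.Product using (∃; _×_; _,_; proj₁; proj₂)
  open import Level using (0ℓ)
  open import Relation.Binary.Definitions using (tri<; tri≈; tri>)
  open import Relation.Binary.PropositionalEquality
    using (refl; sym; trans; cong; cong₂; subst; module ≡-Reasoning)
  open import Relation.Nullary using (¬_; yes; no; contradiction; ¬?)
  open import Relation.Unary using (Pred; Decidable)

  open MixedRadix
  open LeastSearch

  abelianGroup : AbelianGroup 0ℓ 0ℓ
  abelianGroup = record { isAbelianGroup = isAbelianGroup }

  open AbelianGroup abelianGroup
    using (_∙_; _⁻¹; _-_; comm; identityˡ; identityʳ; inverseʳ; monoid; commutativeMonoid; commutativeSemigroup)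
  open import Algebra.Properties.AbelianGroup abelianGroup
    using (⁻¹-∙-comm; ⁻¹-involutive; ⁻¹-anti-homo-//; ε⁻¹≈ε; xyx⁻¹≈y; //-rightDividesˡ; identityʳ-unique)
  open import Algebra.Properties.CommutativeSemigroup commutativeSemigroup using (interchange; xy∙z≈xz∙y)
  open import Algebra.Properties.Monoid.Mult monoid renaming (_×_ to _·_) using (×-homo-+; ×-homo-1)

  -‿identityʳ : ∀ x → x - ε ≡ x
  -‿identityʳ x = trans (cong (x ∙_) ε⁻¹≈ε) (identityʳ x)

  -‿interchange : ∀ a b c d → (a ∙ b) - (c ∙ d) ≡ (a - c) ∙ (b - d)
  -‿interchange a b c d = trans (cong ((a ∙ b) ∙_) (sym (⁻¹-∙-comm c d))) (interchange a b (c ⁻¹) (d ⁻¹))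

  -‿cancelˡ : ∀ x a b → (x - a) - (x - b) ≡ b - a
  -‿cancelˡ x a b = begin
    (x - a) - (x - b)          ≡⟨ -‿interchange x (a ⁻¹) x (b ⁻¹) ⟩
    (x - x) ∙ (a ⁻¹ - b ⁻¹)    ≡⟨ cong₂ _∙_ (inverseʳ x) (cong (a ⁻¹ ∙_) (⁻¹-involutive b)) ⟩
    ε ∙ (a ⁻¹ ∙ b)             ≡⟨ identityˡ _ ⟩
    a ⁻¹ ∙ b                   ≡⟨ comm (a ⁻¹) b ⟩
    b - a                      ∎
    where open ≡-Reasoning

  -‿carry : ∀ z a b → (z - (a ∙ b)) ∙ a ≡ z - b
  -‿carry z a b = begin
    (z - (a ∙ b)) ∙ a          ≡⟨ xy∙z≈xz∙y z ((a ∙ b) ⁻¹) a ⟩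
    (z ∙ a) - (a ∙ b)          ≡⟨ cong ((z ∙ a) -_) (comm a b) ⟩
    (z ∙ a) - (b ∙ a)          ≡⟨ -‿interchange z a b a ⟩
    (z - b) ∙ (a - a)          ≡⟨ cong ((z - b) ∙_) (inverseʳ a) ⟩
    (z - b) ∙ ε                ≡⟨ identityʳ _ ⟩
    z - b                      ∎
    where open ≡-Reasoning

  -‿negate : ∀ x a b → (x - a) ⁻¹ - (a ∙ b) ≡ x ⁻¹ - b
  -‿negate x a b = begin
    (x - a) ⁻¹ - (a ∙ b)       ≡⟨ cong (_- (a ∙ b)) (⁻¹-anti-homo-// x a) ⟩
    (a - x) - (a ∙ b)          ≡⟨ -‿interchange a (x ⁻¹) a b ⟩
    (a - a) ∙ (x ⁻¹ - b)       ≡⟨ cong (_∙ (x ⁻¹ - b)) (inverseʳ a) ⟩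
    ε ∙ (x ⁻¹ - b)             ≡⟨ identityˡ _ ⟩
    x ⁻¹ - b                   ∎
    where open ≡-Reasoning

  finite-order : ∀ g → ∃ λ e → suc e · g ≡ ε
  finite-order g with i , j , i<j , iᵍ≡jᵍ ← pigeonhole (n<1+n m) (λ (i : Fin (suc m)) → toℕ i · g) =
    e , (identityʳ-unique (toℕ i · g) (suc e · g) (begin
      toℕ i · g ∙ suc e · g     ≡⟨ sym (×-homo-+ g (toℕ i) (suc e)) ⟩
      (toℕ i + suc e) · g       ≡⟨ cong (_· g) j≡i+1+e ⟩
      toℕ j · g                 ≡⟨ sym iᵍ≡jᵍ ⟩
      toℕ i · g                 ∎))
    where
    open ≡-Reasoning
    e = toℕ j ∸ suc (toℕ i)
    j≡i+1+e : toℕ i + suc e ≡ toℕ j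
    j≡i+1+e = trans (+-suc (toℕ i) e) (m+[n∸m]≡n i<j)

  record RankedSubgroup : Set₁ where
    field
      K                : Pred (Fin m) 0ℓ
      K?               : Decidable K
      K-ε              : K ε
      K-∙              : ∀ {x y} → K x → K y → K (x ∙ y)
      K-⁻¹             : ∀ {x} → K x → K (x ⁻¹)
      size             : ℕ
      rank             : Fin m → ℕ
      rank<size        : ∀ {x} → K x → rank x < size
      rank-injective   : ∀ {x y} → K x → K y → rank x ≡ rank y → x ≡ y
      rank-surjective  : ∀ {r} → r < size → ∃ λ x → K x × rank x ≡ r
      rank-ε           : rank ε ≡ 0
      rank-subadditive : ∀ {x y} → K x → K y → rank (x ∙ y) ≤ rank x + rank y

  trivial : RankedSubgroup
  trivial = record
    { K                = _≡ ε
    ; K?               = _≟ ε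
    ; K-ε              = refl
    ; K-∙              = λ { refl refl → identityˡ ε }
    ; K-⁻¹             = λ { refl → ε⁻¹≈ε }
    ; size             = 1
    ; rank             = λ _ → 0
    ; rank<size        = λ _ → s≤s z≤n
    ; rank-injective   = λ { refl refl _ → refl }
    ; rank-surjective  = λ { (s≤s z≤n) → ε , refl , refl }
    ; rank-ε           = refl
    ; rank-subadditive = λ _ _ → z≤n
    }

  module _ (S : RankedSubgroup) where
    open RankedSubgroup S
    private
      module GΣ = FilteredSum commutativeMonoid
      module ℕΣ = FilteredSum +-0-commutativeMonoid

    rank-∑⟨⟩ : ∀ {n p} {P : Pred (Fin n) p} (P? : Decidable P) (f : Vector (Fin m) n) → (∀ i → P i → K (f i)) →
               K (GΣ.∑⟨ P? ⟩ f) × rank (GΣ.∑⟨ P? ⟩ f) ≤ ℕΣ.∑⟨ P? ⟩ (rank ∘ f)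
    rank-∑⟨⟩ {zero}  P? f K-f = K-ε , ≤-reflexive rank-ε
    rank-∑⟨⟩ {suc n} P? f K-f with rank-∑⟨⟩ (P? ∘ suc) (f ∘ suc) (K-f ∘ suc) | P? zero
    ... | K-Σ , rank-Σ≤ | yes P0 =
      K-∙ (K-f zero P0) K-Σ , ≤-trans (rank-subadditive (K-f zero P0) K-Σ) (+-monoʳ-≤ (rank (f zero)) rank-Σ≤)
    ... | K-Σ , rank-Σ≤ | no  _  =
      K-∙ K-ε K-Σ , ≤-trans (≤-reflexive (cong rank (identityˡ (GΣ.∑⟨ P? ∘ suc ⟩ (f ∘ suc))))) rank-Σ≤

  module Extension (S : RankedSubgroup) {g : Fin m} (g∉K : ¬ RankedSubgroup.K S g) where
    open RankedSubgroup S

    private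
      N = size
      ρ = rank

    opaque
      period-data : ∃ (Least (λ d → K? (suc d · g)))
      period-data = least (λ d → K? (suc d · g)) {proj₁ (finite-order g)} (subst K (sym (proj₂ (finite-order g))) K-ε)

    q : ℕ
    q = suc (proj₁ period-data)

    K-q·g : K (q · g)
    K-q·g = proj₁ (proj₂ period-data)

    below-period : ∀ {d} → 0 < d → d < q → ¬ K (d · g)
    below-period {suc d} _ (s≤s d<) = proj₂ (proj₂ period-data) d<

    1<q : 1 < q
    1<q with proj₁ period-data | K-q·g
    ... | zero  | K-g = contradiction (subst K (×-homo-1 g) K-g) g∉K
    ... | suc _ | _   = s≤s (s≤s z≤n)

    digit-gap : ∀ {x a b} → a < b → b < q → K (x - a · g) → ¬ K (x - b · g)
    digit-gap {x} {a} {b} a<b b<q kₐ k_b = below-period (m<n⇒0<n∸m a<b) (≤-<-trans (m∸n≤m b a) b<q)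
      (subst K difference (K-∙ kₐ (K-⁻¹ k_b)))
      where
      difference : (x - a · g) - (x - b · g) ≡ (b ∸ a) · g
      difference = begin
        (x - a · g) - (x - b · g)        ≡⟨ -‿cancelˡ x (a · g) (b · g) ⟩
        b · g - a · g                    ≡⟨ cong (λ c → c · g - a · g) (sym (m+[n∸m]≡n (<⇒≤ a<b))) ⟩
        (a + (b ∸ a)) · g - a · g        ≡⟨ cong (_- a · g) (×-homo-+ g a (b ∸ a)) ⟩
        a · g ∙ (b ∸ a) · g - a · g      ≡⟨ xyx⁻¹≈y (a · g) ((b ∸ a) · g) ⟩
        (b ∸ a) · g                      ∎
        where open ≡-Reasoning

    digit-unique : ∀ {x d d′} → d < q → d′ < q → K (x - d · g) → K (x - d′ · g) → d ≡ d′
    digit-unique {d = d} {d′} d<q d′<q k k′ with <-cmp d d′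
    ... | tri< d<d′ _ _ = contradiction k′ (digit-gap d<d′ d′<q k)
    ... | tri≈ _ d≡d′ _ = d≡d′
    ... | tri> _ _ d′<d = contradiction k (digit-gap d′<d d<q k′)

    K′ : Pred (Fin m) 0ℓ
    K′ x = ∃ λ d → d < q × K (x - d · g)

    K′? : Decidable K′
    K′? x = anyUpTo? (λ d → K? (x - d · g)) q

    rank′ : Fin m → ℕ
    rank′ x with K′? x
    ... | yes (d , _) = d * N + ρ (x - d · g)
    ... | no _        = 0

    rank′-digit : ∀ {x d} → d < q → K (x - d · g) → rank′ x ≡ d * N + ρ (x - d · g)
    rank′-digit {x} d<q k with K′? x
    ... | yes (d′ , d′<q , k′) with refl ← digit-unique d′<q d<q k′ k = refl
    ... | no ∄ = contradiction (_ , d<q , k) ∄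

    data DigitSum (d e : ℕ) : Set where
      no-carry : d + e < q → DigitSum d e
      carry    : ∀ f → f < q → d + e ≡ q + f → DigitSum d e

    digit-sum : ∀ {d e} → d < q → e < q → DigitSum d e
    digit-sum {d} {e} d<q e<q with d + e <? q
    ... | yes d+e<q = no-carry d+e<q
    ... | no  d+e≮q = carry f (+-cancelˡ-< q f q (subst (_< q + q) d+e≡q+f (+-mono-< d<q e<q))) d+e≡q+f
      where
      f = d + e ∸ q
      d+e≡q+f = sym (m+[n∸m]≡n (≮⇒≥ d+e≮q))

    sum-no-carry : ∀ x y d e → (x ∙ y) - (d + e) · g ≡ (x - d · g) ∙ (y - e · g)
    sum-no-carry x y d e = trans (cong ((x ∙ y) -_) (×-homo-+ g d e)) (-‿interchange x y (d · g) (e · g))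

    sum-carry : ∀ x y d e f → d + e ≡ q + f → (x ∙ y) - f · g ≡ ((x - d · g) ∙ (y - e · g)) ∙ q · g
    sum-carry x y d e f d+e≡q+f = begin
      (x ∙ y) - f · g                           ≡⟨ sym (-‿carry (x ∙ y) (q · g) (f · g)) ⟩
      ((x ∙ y) - (q · g ∙ f · g)) ∙ q · g       ≡⟨ cong (λ c → ((x ∙ y) - c) ∙ q · g) (sym (×-homo-+ g q f)) ⟩
      ((x ∙ y) - (q + f) · g) ∙ q · g           ≡⟨ cong (λ c → ((x ∙ y) - c · g) ∙ q · g) (sym d+e≡q+f) ⟩
      ((x ∙ y) - (d + e) · g) ∙ q · g           ≡⟨ cong (_∙ q · g) (sum-no-carry x y d e) ⟩
      ((x - d · g) ∙ (y - e · g)) ∙ q · g       ∎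
      where open ≡-Reasoning

    0<q : 0 < q
    0<q = s≤s z≤n

    K′-ε : K′ ε
    K′-ε = 0 , 0<q , subst K (sym (inverseʳ ε)) K-ε

    K′-∙ : ∀ {x y} → K′ x → K′ y → K′ (x ∙ y)
    K′-∙ {x} {y} (d , d<q , kx) (e , e<q , ky) with digit-sum d<q e<q
    ... | no-carry d+e<q = d + e , d+e<q , subst K (sym (sum-no-carry x y d e)) (K-∙ kx ky)
    ... | carry f f<q eq = f , f<q , subst K (sym (sum-carry x y d e f eq)) (K-∙ (K-∙ kx ky) K-q·g)

    K′-⁻¹ : ∀ {x} → K′ x → K′ (x ⁻¹)
    K′-⁻¹ {x} (zero , _ , k) =
      0 , 0<q , subst K (sym (-‿identityʳ (x ⁻¹))) (K-⁻¹ (subst K (-‿identityʳ x) k))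
    K′-⁻¹ {x} (d@(suc _) , d<q , k) =
      q ∸ d , ∸-monoʳ-< (s≤s z≤n) (<⇒≤ d<q) ,
      subst K (-‿negate x (d · g) ((q ∸ d) · g)) (K-∙ (K-⁻¹ k) (K-⁻¹ K-d·g∙[q∸d]·g))
      where
      K-d·g∙[q∸d]·g : K (d · g ∙ (q ∸ d) · g)
      K-d·g∙[q∸d]·g = subst K (trans (cong (_· g) (sym (m+[n∸m]≡n (<⇒≤ d<q)))) (×-homo-+ g d (q ∸ d))) K-q·g

    rank′<size′ : ∀ {x} → K′ x → rank′ x < q * N
    rank′<size′ (d , d<q , k) rewrite rank′-digit d<q k = place-value-< d<q (rank<size k)

    rank′-injective : ∀ {x y} → K′ x → K′ y → rank′ x ≡ rank′ y → x ≡ y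
    rank′-injective {x} {y} (d , d<q , kx) (e , e<q , ky) eq
      rewrite rank′-digit d<q kx | rank′-digit e<q ky
      with refl , ρ≡ ← place-value-injective d e (rank<size kx) (rank<size ky) eq = begin
        x                          ≡⟨ sym (//-rightDividesˡ (d · g) x) ⟩
        (x - d · g) ∙ d · g        ≡⟨ cong (_∙ d · g) (rank-injective kx ky ρ≡) ⟩
        (y - d · g) ∙ d · g        ≡⟨ //-rightDividesˡ (d · g) y ⟩
        y                          ∎
      where open ≡-Reasoning

    rank′-surjective : ∀ {r} → r < q * N → ∃ λ x → K′ x × rank′ x ≡ r
    rank′-surjective {r} r<qN
      with d , a , d<q , a<N , r≡ ← place-value-split q {N} r<qN
      with k , K-k , ρk≡a ← rank-surjective a<N = d · g ∙ k , (d , d<q , K-k′) , (begin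
        rank′ (d · g ∙ k)                   ≡⟨ rank′-digit d<q K-k′ ⟩
        d * N + ρ (d · g ∙ k - d · g)       ≡⟨ cong (λ c → d * N + ρ c) (xyx⁻¹≈y (d · g) k) ⟩
        d * N + ρ k                         ≡⟨ cong (d * N +_) ρk≡a ⟩
        d * N + a                           ≡⟨ sym r≡ ⟩
        r                                   ∎)
      where
      open ≡-Reasoning
      K-k′ : K (d · g ∙ k - d · g)
      K-k′ = subst K (sym (xyx⁻¹≈y (d · g) k)) K-k

    rank′-ε : rank′ ε ≡ 0
    rank′-ε = trans (rank′-digit 0<q (proj₂ (proj₂ K′-ε))) (trans (cong ρ (inverseʳ ε)) rank-ε)

    rank′-subadditive : ∀ {x y} → K′ x → K′ y → rank′ (x ∙ y) ≤ rank′ x + rank′ y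
    rank′-subadditive {x} {y} (d , d<q , kx) (e , e<q , ky)
      rewrite rank′-digit d<q kx | rank′-digit e<q ky with digit-sum d<q e<q
    ... | no-carry d+e<q = begin
      rank′ (x ∙ y)                                  ≡⟨ rank′-digit d+e<q K-digit ⟩
      (d + e) * N + ρ ((x ∙ y) - (d + e) · g)        ≡⟨ cong (λ c → (d + e) * N + ρ c) (sum-no-carry x y d e) ⟩
      (d + e) * N + ρ (x′ ∙ y′)                      ≤⟨ +-monoʳ-≤ ((d + e) * N) (rank-subadditive kx ky) ⟩
      (d + e) * N + (ρ x′ + ρ y′)                    ≡⟨ place-value-+ d e N (ρ x′) (ρ y′) ⟩
      (d * N + ρ x′) + (e * N + ρ y′)                ∎
      where
      open ≤-Reasoning
      x′ = x - d · g
      y′ = y - e · g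
      K-digit = subst K (sym (sum-no-carry x y d e)) (K-∙ kx ky)
    ... | carry f f<q d+e≡q+f = begin
      rank′ (x ∙ y)                                  ≡⟨ rank′-digit f<q K-digit ⟩
      f * N + ρ ((x ∙ y) - f · g)                    ≡⟨ cong (λ c → f * N + ρ c) (sum-carry x y d e f d+e≡q+f) ⟩
      f * N + ρ ((x′ ∙ y′) ∙ q · g)                  ≤⟨ +-monoʳ-≤ (f * N) (≤-trans (rank-subadditive (K-∙ kx ky) K-q·g)
                                                           (+-mono-≤ (rank-subadditive kx ky) (<⇒≤ (rank<size K-q·g)))) ⟩
      f * N + ((ρ x′ + ρ y′) + N)                    ≡⟨ absorb-carry f N (ρ x′ + ρ y′) ⟩
      suc f * N + (ρ x′ + ρ y′)                      ≤⟨ +-monoˡ-≤ (ρ x′ + ρ y′) (*-monoˡ-≤ N 1+f≤d+e) ⟩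
      (d + e) * N + (ρ x′ + ρ y′)                    ≡⟨ place-value-+ d e N (ρ x′) (ρ y′) ⟩
      (d * N + ρ x′) + (e * N + ρ y′)                ∎
      where
      open ≤-Reasoning
      x′ = x - d · g
      y′ = y - e · g
      K-digit = subst K (sym (sum-carry x y d e f d+e≡q+f)) (K-∙ (K-∙ kx ky) K-q·g)
      1+f≤d+e : suc f ≤ d + e
      1+f≤d+e = subst (suc f ≤_) (sym d+e≡q+f) (+-monoˡ-≤ f (<⇒≤ 1<q))

    extended : RankedSubgroup
    extended = record
      { K                = K′
      ; K?               = K′?
      ; K-ε              = K′-ε
      ; K-∙              = K′-∙
      ; K-⁻¹             = K′-⁻¹
      ; size             = q * N
      ; rank             = rank′
      ; rank<size        = rank′<size′
      ; rank-injective   = rank′-injective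
      ; rank-surjective  = rank′-surjective
      ; rank-ε           = rank′-ε
      ; rank-subadditive = rank′-subadditive
      }

    size-grows : N < q * N
    size-grows = begin-strict
      N          <⟨ m<m+n N (≤-<-trans z≤n (rank<size K-ε)) ⟩
      N + N      ≡⟨ cong (N +_) (sym (+-identityʳ N)) ⟩
      2 * N      ≤⟨ *-monoˡ-≤ N 1<q ⟩
      q * N      ∎
      where open ≤-Reasoning

  size-covers : (S : RankedSubgroup) → (∀ x → RankedSubgroup.K S x) → m ≤ RankedSubgroup.size S
  size-covers S all-in = injective⇒≤ {f = λ x → fromℕ< (rank<size (all-in x))} λ {x} {y} eq →
    rank-injective (all-in x) (all-in y) (trans (sym (toℕ-fromℕ< _)) (trans (cong toℕ eq) (toℕ-fromℕ< _)))
    where open RankedSubgroup S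

  ranked-subgroup-beyond : ∀ {b} → b < m → ∃ λ S → b < RankedSubgroup.size S
  ranked-subgroup-beyond {b} b<m = grow m trivial (m≤n+m m 1)
    where
    open RankedSubgroup using (K; K?; size)

    covered : ∀ S → ¬ (∃ λ x → ¬ K S x) → ∀ x → K S x
    covered S ∄g∉K x = decidable-stable (K? S x) (∄g∉K ∘ (x ,_))

    grow : ∀ fuel (S : RankedSubgroup) → m ≤ size S + fuel → ∃ λ S → b < size S
    grow fuel S m≤N+fuel with b <? size S
    ... | yes b<N = S , b<N
    ... | no  b≮N with any? (λ x → ¬? (K? S x))
    ...   | no  ∄g∉K = contradiction (<-≤-trans b<m (size-covers S (covered S ∄g∉K))) b≮N
    ...   | yes (g , g∉K) with fuel
    ...     | zero      = contradiction (<-≤-trans b<m (subst (m ≤_) (+-identityʳ _) m≤N+fuel)) b≮N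
    ...     | suc fuel′ = grow fuel′ (Extension.extended S g∉K) (begin
      m                        ≤⟨ m≤N+fuel ⟩
      size S + suc fuel′       ≡⟨ +-suc (size S) fuel′ ⟩
      suc (size S) + fuel′     ≤⟨ +-monoˡ-≤ fuel′ (Extension.size-grows S g∉K) ⟩
      size (Extension.extended S g∉K) + fuel′ ∎)
      where open ≤-Reasoning

module RootedTree {n : ℕ} (T : Graph n) (tree : IsTree T) where
  open import Data.Bool using (Bool; true)
  import Data.Bool.Properties as Bool
  open import Data.Empty using (⊥)
  open import Data.Fin using (Fin; toℕ; _≟_)
  open import Data.Fin.Properties using (any?; toℕ-injective; toℕ<n; toℕ-inject₁; toℕ-fromℕ)
  import Data.Nat as ℕ
  open import Data.Nat using (zero; suc; _+_; _∸_; _≤_; _<_; _≤?_; _<?_; z≤n; s≤s)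
  open import Data.Nat.Properties
    using (+-cancelʳ-<; +-cancelʳ-≡; +-cancelʳ-≤; +-cancelˡ-≡; +-cancelˡ-≤; +-comm; +-identityʳ;
           +-mono-≤; +-monoˡ-≤; +-suc; <-irrefl; <⇒≤; <⇒≱; >⇒≢; m+n∸m≡n; m+n∸n≡m; m+n≤o⇒m≤o;
           m<m+n; m∸n+n≡m; m∸n≤m; m≤m+n; m≤n⇒m<n∨m≡n; m≤n⇒m≤1+n; n<1+n; n∸n≡0; suc-injective;
           ∸-cancelˡ-≡; ∸-monoʳ-<; ∸-monoʳ-≤; ≤-<-connex; ≤-antisym; ≤-pred; ≤-refl; ≤-reflexive;
           ≤-total; ≤-trans; ≤∧≢⇒<; module ≤-Reasoning)
  open import Data.Product using (∃; _×_; _,_; proj₁; proj₂)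
  open import Data.Sum using (_⊎_; inj₁; inj₂)
  open import Level using (0ℓ)
  open import Relation.Binary.PropositionalEquality
    using (_≡_; _≢_; refl; sym; trans; cong; subst; subst₂; module ≡-Reasoning)
  open import Relation.Nullary using (¬_; ¬?; Dec; yes; no; contradiction)
  open import Relation.Nullary.Decidable using (_⊎-dec_; _×-dec_; decidable-stable; map′)
  open import Relation.Unary using (Pred; Decidable)

  open LeastSearch

  open Graph T using (adj) renaming (sym to adj-sym; irrefl to adj-irrefl)

  root : Fin n
  root = proj₁ (proj₁ (proj₁ tree))

  Within : ℕ → Pred (Fin n) 0ℓ
  Within zero    v = v ≡ root
  Within (suc k) v = Within k v ⊎ ∃ λ u → Within k u × Edge T u v

  within? : ∀ k → Decidable (Within k)
  within? zero    v = v ≟ root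
  within? (suc k) v = within? k v ⊎-dec any? (λ u → within? k u ×-dec (adj u v Bool.≟ true))

  walk-within : ∀ {A x z k} → WalkIn T A x z → Within k x → ∃ λ l → Within l z
  walk-within (here _)        w = _ , w
  walk-within (step _ e rest) w = walk-within rest (inj₂ (_ , w , e))

  opaque
    depth-data : ∀ v → ∃ (Least (λ k → within? k v))
    depth-data v = least (λ k → within? k v) (proj₂ (walk-within (proj₂ (proj₁ tree) root v refl refl) refl))

  depth : Fin n → ℕ
  depth v = proj₁ (depth-data v)

  within-depth : ∀ v → Within (depth v) v
  within-depth v = proj₁ (proj₂ (depth-data v))

  depth-least : ∀ {k v} → Within k v → depth v ≤ k
  depth-least {v = v} = least-≤ (λ k → within? k v) (proj₂ (depth-data v))

  depth-edge : ∀ {u v} → Edge T u v → depth v ≤ suc (depth u)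
  depth-edge {u} e = depth-least (inj₂ (u , within-depth u , e))

  depth≡0 : ∀ {v} → depth v ≡ 0 → v ≡ root
  depth≡0 {v} eq = subst (λ k → Within k v) eq (within-depth v)

  parent-data : ∀ v → ∃ λ u → depth v ≡ 0 ⊎ (depth v ≡ suc (depth u) × Edge T u v)
  parent-data v with depth v in eq | within-depth v
  ... | zero  | _ = v , inj₁ refl
  ... | suc d | inj₁ w = contradiction w (proj₂ (proj₂ (depth-data v)) (subst (d <_) (sym eq) (n<1+n d)))
  ... | suc d | inj₂ (u , w , e) = u , inj₂ (cong suc (≤-antisym d≤depth-u (depth-least w)) , e)
    where
    d≤depth-u : d ≤ depth u
    d≤depth-u = ≤-pred (subst (_≤ suc (depth u)) eq (depth-edge e))

  -- The root is its own parent; the lemmas about parent v all assume 0 < depth v.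
  parent : Fin n → Fin n
  parent v = proj₁ (parent-data v)

  parent-spec : ∀ {v} → 0 < depth v → suc (depth (parent v)) ≡ depth v × Edge T (parent v) v
  parent-spec {v} 0<depth with proj₂ (parent-data v)
  ... | inj₁ eq₀     = contradiction eq₀ (>⇒≢ 0<depth)
  ... | inj₂ (eq , e) = sym eq , e

  up : ℕ → Fin n → Fin n
  up zero    v = v
  up (suc i) v = parent (up i v)

  up-+ : ∀ i j v → up (i + j) v ≡ up i (up j v)
  up-+ zero    j v = refl
  up-+ (suc i) j v = cong parent (up-+ i j v)

  depth-up : ∀ {i v} → i ≤ depth v → depth (up i v) + i ≡ depth v
  up-nonroot : ∀ {i v} → suc i ≤ depth v → 0 < depth (up i v)

  depth-up {zero}  _ = +-identityʳ _
  depth-up {suc i} {v} i<depth = begin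
    depth (up (suc i) v) + suc i       ≡⟨ +-suc _ i ⟩
    suc (depth (up (suc i) v)) + i     ≡⟨ cong (_+ i) (proj₁ (parent-spec (up-nonroot i<depth))) ⟩
    depth (up i v) + i                 ≡⟨ depth-up (<⇒≤ i<depth) ⟩
    depth v                            ∎
    where open ≡-Reasoning

  up-nonroot {i} {v} i<depth = +-cancelʳ-< i 0 _ (subst (i <_) (sym (depth-up (<⇒≤ i<depth))) i<depth)

  depth-up≤ : ∀ {i v} → i ≤ depth v → depth (up i v) ≤ depth v
  depth-up≤ i≤ = m+n≤o⇒m≤o _ (≤-reflexive (depth-up i≤))

  edge-up : ∀ {i v} → suc i ≤ depth v → Edge T (up (suc i) v) (up i v)
  edge-up i<depth = proj₂ (parent-spec (up-nonroot i<depth))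

  up-depth : ∀ v → up (depth v) v ≡ root
  up-depth v = depth≡0 (+-cancelʳ-≡ (depth v) _ 0 (depth-up ≤-refl))

  up-injective : ∀ {a b s t} → depth a ≡ depth b → s ≤ depth a → t ≤ depth b → up s a ≡ up t b → s ≡ t
  up-injective {a} {b} {s} {t} da≡db s≤ t≤ eq = +-cancelˡ-≡ (depth (up s a)) s t (begin
    depth (up s a) + s   ≡⟨ depth-up s≤ ⟩
    depth a              ≡⟨ da≡db ⟩
    depth b              ≡⟨ sym (depth-up t≤) ⟩
    depth (up t b) + t   ≡⟨ cong (λ w → depth w + t) (sym eq) ⟩
    depth (up s a) + t   ∎)
    where open ≡-Reasoning

  record Path (k : ℕ) : Set where
    field
      vertex    : ℕ → Fin n
      injective : ∀ {s t} → s ≤ k → t ≤ k → vertex s ≡ vertex t → s ≡ t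
      edge      : ∀ {s} → s < k → Edge T (vertex s) (vertex (suc s))

  close : ∀ {k} (P : Path k) → 2 ≤ k → Edge T (Path.vertex P k) (Path.vertex P 0) → Cycle T
  close {k} P 2≤k e = record
    { k      = k
    ; len≥3  = 2≤k
    ; v      = λ i → vertex (toℕ i)
    ; v-inj  = λ i j eq → toℕ-injective (injective (≤-pred (toℕ<n i)) (≤-pred (toℕ<n j)) eq)
    ; edges  = λ i → subst (λ s → Edge T (vertex s) (vertex (suc (toℕ i)))) (sym (toℕ-inject₁ i)) (edge (toℕ<n i))
    ; close  = subst (λ s → Edge T (vertex s) (vertex 0)) (sym (toℕ-fromℕ k)) e
    }
    where open Path P

  close-through : ∀ {k} (P : Path k) {y : Fin n} → (∀ {s} → s ≤ k → Path.vertex P s ≢ y) →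
                  Edge T (Path.vertex P k) y → Edge T y (Path.vertex P 0) → 1 ≤ k → Cycle T
  close-through {k} P {y} off-path e e′ 1≤k =
    close (record { vertex = vertex′ ; injective = injective′ ; edge = edge′ }) (s≤s 1≤k)
          (subst₂ (Edge T) (sym vertex′-last) (sym (vertex′-≤ z≤n)) e′)
    where
    open Path P
    vertex′ : ℕ → Fin n
    vertex′ s with s ≤? k
    ... | yes _ = vertex s
    ... | no  _ = y

    vertex′-≤ : ∀ {s} → s ≤ k → vertex′ s ≡ vertex s
    vertex′-≤ {s} s≤k with s ≤? k
    ... | yes _   = refl
    ... | no  s≰k = contradiction s≤k s≰k

    vertex′-last : vertex′ (suc k) ≡ y
    vertex′-last with suc k ≤? k
    ... | yes 1+k≤k = contradiction 1+k≤k (<-irrefl refl)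
    ... | no  _     = refl

    injective′ : ∀ {s t} → s ≤ suc k → t ≤ suc k → vertex′ s ≡ vertex′ t → s ≡ t
    injective′ {s} {t} s≤ t≤ eq = by-position (m≤n⇒m<n∨m≡n s≤) (m≤n⇒m<n∨m≡n t≤)
      where
      by-position : s < suc k ⊎ s ≡ suc k → t < suc k ⊎ t ≡ suc k → s ≡ t
      by-position (inj₁ (s≤s s≤k)) (inj₁ (s≤s t≤k)) =
        injective s≤k t≤k (trans (sym (vertex′-≤ s≤k)) (trans eq (vertex′-≤ t≤k)))
      by-position (inj₁ (s≤s s≤k)) (inj₂ refl) =
        contradiction (trans (sym (vertex′-≤ s≤k)) (trans eq vertex′-last)) (off-path s≤k)
      by-position (inj₂ refl) (inj₁ (s≤s t≤k)) =
        contradiction (trans (sym (vertex′-≤ t≤k)) (trans (sym eq) vertex′-last)) (off-path t≤k)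
      by-position (inj₂ refl) (inj₂ refl) = refl

    edge′ : ∀ {s} → s < suc k → Edge T (vertex′ s) (vertex′ (suc s))
    edge′ {s} (s≤s s≤k) = by-position (m≤n⇒m<n∨m≡n s≤k)
      where
      by-position : s < k ⊎ s ≡ k → Edge T (vertex′ s) (vertex′ (suc s))
      by-position (inj₁ s<k) = subst₂ (Edge T) (sym (vertex′-≤ s≤k)) (sym (vertex′-≤ s<k)) (edge s<k)
      by-position (inj₂ refl) = subst₂ (Edge T) (sym (vertex′-≤ s≤k)) (sym vertex′-last) e

  ∸≡suc∸suc : ∀ {m n} → n < m → m ∸ n ≡ suc (m ∸ suc n)
  ∸≡suc∸suc {suc m} {zero}  _         = refl
  ∸≡suc∸suc {suc m} {suc n} (s≤s n<m) = ∸≡suc∸suc n<m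

  module Meeting {a b : Fin n} (a≢b : a ≢ b) (da≡db : depth a ≡ depth b) where

    meet-at-root : up (depth a) a ≡ up (depth a) b
    meet-at-root = trans (up-depth a) (sym (trans (cong (λ j → up j b) da≡db) (up-depth b)))

    opaque
      meet-data : ∃ (Least (λ j → up j a ≟ up j b))
      meet-data = least (λ j → up j a ≟ up j b) {depth a} meet-at-root

    j : ℕ
    j = proj₁ meet-data

    meet : up j a ≡ up j b
    meet = proj₁ (proj₂ meet-data)

    j≤depth : j ≤ depth a
    j≤depth = least-≤ (λ j → up j a ≟ up j b) {b = depth a} (proj₂ meet-data) meet-at-root

    0<j : 0 < j
    0<j with j in eq
    ... | zero  = contradiction (subst (λ i → up i a ≡ up i b) eq meet) a≢b
    ... | suc _ = s≤s z≤n

    -- the walk a, parent a, …, up j a = up j b, …, parent b, b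
    vertex : ℕ → Fin n
    vertex s with s ≤? j
    ... | yes _ = up s a
    ... | no  _ = up (j + j ∸ s) b

    vertex-left : ∀ {s} → s ≤ j → vertex s ≡ up s a
    vertex-left {s} s≤j with s ≤? j
    ... | yes _   = refl
    ... | no  s≰j = contradiction s≤j s≰j

    vertex-right : ∀ {s} → j ≤ s → vertex s ≡ up (j + j ∸ s) b
    vertex-right {s} j≤s with s ≤? j
    ... | no  _   = refl
    ... | yes s≤j with refl ← ≤-antisym s≤j j≤s = trans meet (cong (λ i → up i b) (sym (m+n∸n≡m j j)))

    right-height : ∀ {s} → j < s → s ≤ j + j → j + j ∸ s < j
    right-height {s} j<s s≤2j = subst (j + j ∸ s <_) (m+n∸n≡m j j) (∸-monoʳ-< j<s s≤2j)

    up-a-injective : ∀ {s t} → s ≤ j → t ≤ j → up s a ≡ up t a → s ≡ t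
    up-a-injective s≤j t≤j = up-injective refl (≤-trans s≤j j≤depth) (≤-trans t≤j j≤depth)

    up-b-injective : ∀ {s t} → s ≤ j → t ≤ j → up s b ≡ up t b → s ≡ t
    up-b-injective s≤j t≤j = up-injective refl (≤-trans s≤j j≤b) (≤-trans t≤j j≤b)
      where j≤b = subst (j ≤_) da≡db j≤depth

    sides-disjoint : ∀ {s t} → s ≤ j → t < j → up s a ≢ up t b
    sides-disjoint {s} {t} s≤j t<j eq with refl ← up-injective da≡db (≤-trans s≤j j≤depth)
                                                   (subst (t ≤_) da≡db (≤-trans (<⇒≤ t<j) j≤depth)) eq =
      proj₂ (proj₂ meet-data) t<j eq

    vertex-injective : ∀ {s t} → s ≤ j + j → t ≤ j + j → vertex s ≡ vertex t → s ≡ t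
    vertex-injective {s} {t} s≤2j t≤2j eq = by-sides (≤-<-connex s j) (≤-<-connex t j)
      where
      by-sides : s ≤ j ⊎ j < s → t ≤ j ⊎ j < t → s ≡ t
      by-sides (inj₁ s≤j) (inj₁ t≤j) =
        up-a-injective s≤j t≤j (trans (sym (vertex-left s≤j)) (trans eq (vertex-left t≤j)))
      by-sides (inj₁ s≤j) (inj₂ j<t) =
        contradiction (trans (sym (vertex-left s≤j)) (trans eq (vertex-right (<⇒≤ j<t))))
                      (sides-disjoint s≤j (right-height j<t t≤2j))
      by-sides (inj₂ j<s) (inj₁ t≤j) =
        contradiction (trans (sym (vertex-left t≤j)) (trans (sym eq) (vertex-right (<⇒≤ j<s))))
                      (sides-disjoint t≤j (right-height j<s s≤2j))
      by-sides (inj₂ j<s) (inj₂ j<t) = ∸-cancelˡ-≡ s≤2j t≤2j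
        (up-b-injective (<⇒≤ (right-height j<s s≤2j)) (<⇒≤ (right-height j<t t≤2j))
          (trans (sym (vertex-right (<⇒≤ j<s))) (trans eq (vertex-right (<⇒≤ j<t)))))

    vertex-edge : ∀ {s} → s < j + j → Edge T (vertex s) (vertex (suc s))
    vertex-edge {s} s<2j = by-side (≤-<-connex (suc s) j)
      where
      by-side : suc s ≤ j ⊎ j < suc s → Edge T (vertex s) (vertex (suc s))
      by-side (inj₁ s<j) = subst₂ (Edge T) (sym (vertex-left (<⇒≤ s<j))) (sym (vertex-left s<j))
                             (trans (adj-sym _ _) (edge-up (≤-trans s<j j≤depth)))
      by-side (inj₂ j<1+s) = subst₂ (Edge T) (sym vertex-s) (sym (vertex-right (m≤n⇒m≤1+n j≤s))) (edge-up 1+h≤depth-b)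
        where
        j≤s = ≤-pred j<1+s
        h = j + j ∸ suc s
        vertex-s : vertex s ≡ up (suc h) b
        vertex-s = trans (vertex-right j≤s) (cong (λ i → up i b) (∸≡suc∸suc s<2j))
        1+h≤j : suc h ≤ j
        1+h≤j = subst (_≤ j) (∸≡suc∸suc s<2j) (≤-trans (∸-monoʳ-≤ (j + j) j≤s) (≤-reflexive (m+n∸n≡m j j)))
        1+h≤depth-b : suc h ≤ depth b
        1+h≤depth-b = subst (suc h ≤_) da≡db (≤-trans 1+h≤j j≤depth)

    path : Path (j + j)
    path = record { vertex = vertex ; injective = vertex-injective ; edge = vertex-edge }

    path-start : vertex 0 ≡ a
    path-start = vertex-left z≤n

    path-end : vertex (j + j) ≡ b
    path-end = trans (vertex-right (m≤m+n j j)) (cong (λ i → up i b) (n∸n≡0 (j + j)))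

    2≤length : 2 ≤ j + j
    2≤length = +-mono-≤ 0<j 0<j

    depth-vertex : ∀ {s} → s ≤ j + j → depth (vertex s) ≤ depth a
    depth-vertex {s} s≤2j = by-side (≤-<-connex s j)
      where
      by-side : s ≤ j ⊎ j < s → depth (vertex s) ≤ depth a
      by-side (inj₁ s≤j) = subst (λ v → depth v ≤ depth a) (sym (vertex-left s≤j)) (depth-up≤ (≤-trans s≤j j≤depth))
      by-side (inj₂ j<s) = subst (λ v → depth v ≤ depth a) (sym (vertex-right (<⇒≤ j<s)))
                             (subst (depth (up h b) ≤_) (sym da≡db) (depth-up≤ h≤db))
        where
        h = j + j ∸ s
        h≤db : h ≤ depth b
        h≤db = subst (h ≤_) da≡db (≤-trans (<⇒≤ (right-height j<s s≤2j)) j≤depth)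

  no-edge-within-level : ∀ {a b} → Edge T a b → depth a ≢ depth b
  no-edge-within-level {a} {b} e da≡db =
    proj₂ tree (close path 2≤length (subst₂ (Edge T) (sym path-end) (sym path-start) (trans (adj-sym b a) e)))
    where
    a≢b : a ≢ b
    a≢b refl = contradiction (trans (sym (adj-irrefl a)) e) λ ()
    open Meeting a≢b da≡db

  unique-parent : ∀ {a b y} → a ≢ b → depth a ≡ depth b → suc (depth a) ≡ depth y → Edge T a y → Edge T b y → ⊥
  unique-parent {a} {b} {y} a≢b da≡db 1+da≡dy ay by =
    proj₂ tree (close-through path off-path (subst (λ v → Edge T v y) (sym path-end) by)
                              (subst (Edge T y) (sym path-start) (trans (adj-sym y a) ay)) (≤-trans (s≤s z≤n) 2≤length))
    where
    open Meeting a≢b da≡db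
    off-path : ∀ {s} → s ≤ j + j → vertex s ≢ y
    off-path s≤2j eq = contradiction (subst (λ v → depth v ≤ depth a) eq (depth-vertex s≤2j))
                                     (<⇒≱ (subst (depth a <_) 1+da≡dy (n<1+n (depth a))))

  edge-parent : ∀ {x y} → Edge T x y → depth x ≤ depth y → parent y ≡ x × suc (depth x) ≡ depth y
  edge-parent {x} {y} e dx≤dy with depth x ℕ.≟ depth y
  ... | yes dx≡dy = contradiction dx≡dy (no-edge-within-level e)
  ... | no  dx≢dy = decidable-stable (parent y ≟ x) parent-is-x , 1+dx≡dy
    where
    1+dx≡dy : suc (depth x) ≡ depth y
    1+dx≡dy = ≤-antisym (≤∧≢⇒< dx≤dy dx≢dy) (depth-edge e)
    parent-y = parent-spec {y} (subst (0 <_) 1+dx≡dy (s≤s z≤n))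
    parent-is-x : ¬ parent y ≢ x
    parent-is-x py≢x = unique-parent py≢x (suc-injective (trans (proj₁ parent-y) (sym 1+dx≡dy)))
                                       (proj₁ parent-y) (proj₂ parent-y) e

  edge-parent-or-child : ∀ {x y} → Edge T x y →
                         (parent y ≡ x × suc (depth x) ≡ depth y) ⊎ (parent x ≡ y × suc (depth y) ≡ depth x)
  edge-parent-or-child {x} {y} e with ≤-total (depth x) (depth y)
  ... | inj₁ dx≤dy = inj₁ (edge-parent e dx≤dy)
  ... | inj₂ dy≤dx = inj₂ (edge-parent (trans (adj-sym y x) e) dy≤dx)

  infix 4 _≼_ _≼?_

  _≼_ : Fin n → Fin n → Set
  w ≼ x = ∃ λ i → i ≤ depth x × up i x ≡ w

  ≼-depth : ∀ {w x} ((i , _) : w ≼ x) → depth w + i ≡ depth x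
  ≼-depth (i , i≤ , refl) = depth-up i≤

  ≼⇒depth≤ : ∀ {w x} → w ≼ x → depth w ≤ depth x
  ≼⇒depth≤ (_ , i≤ , refl) = depth-up≤ i≤

  ≼-refl : ∀ {x} → x ≼ x
  ≼-refl = 0 , z≤n , refl

  ≼-trans : ∀ {u w x} → u ≼ w → w ≼ x → u ≼ x
  ≼-trans {x = x} (j , j≤ , refl) w≼x@(i , i≤ , refl) =
    j + i , subst (j + i ≤_) (≼-depth w≼x) (+-monoˡ-≤ i j≤) , up-+ j i x

  parent≼ : ∀ {x} → 0 < depth x → parent x ≼ x
  parent≼ 0<depth = 1 , 0<depth , refl

  ≼-parent : ∀ {w x} → w ≼ x → w ≢ x → w ≼ parent x
  ≼-parent (zero , _ , refl) w≢x = contradiction refl w≢x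
  ≼-parent {x = x} (suc i , i<depth , refl) _ =
    i , ≤-pred (subst (suc i ≤_) (sym (proj₁ (parent-spec (≤-trans (s≤s z≤n) i<depth)))) i<depth) ,
    trans (sym (up-+ i 1 x)) (cong (λ k → up k x) (+-comm i 1))

  ≼-level : ∀ {w x} → w ≼ x → depth x ≤ depth w → w ≡ x
  ≼-level w≼x@(zero  , _ , refl) _ = refl
  ≼-level w≼x@(suc i , _ , _) dx≤dw =
    contradiction (subst (_≤ _) (sym (≼-depth w≼x)) dx≤dw) (<⇒≱ (m<m+n _ (s≤s z≤n)))

  ≼-chain : ∀ {c c′ x} → c ≼ x → c′ ≼ x → depth c′ ≤ depth c → c′ ≼ c
  ≼-chain {x = x} c≼x@(i , i≤ , refl) c′≼x@(i′ , i′≤ , refl) dc′≤dc =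
    i′ ∸ i , +-cancelʳ-≤ i _ _ (subst₂ _≤_ (sym (m∸n+n≡m i≤i′)) (sym (≼-depth c≼x)) i′≤) ,
    trans (sym (up-+ (i′ ∸ i) i x)) (cong (λ k → up k x) (m∸n+n≡m i≤i′))
    where
    i≤i′ : i ≤ i′
    i≤i′ = +-cancelˡ-≤ (depth (up i′ x)) i i′ (begin
      depth (up i′ x) + i   ≤⟨ +-monoˡ-≤ i dc′≤dc ⟩
      depth (up i x) + i    ≡⟨ ≼-depth c≼x ⟩
      depth x               ≡⟨ sym (≼-depth c′≼x) ⟩
      depth (up i′ x) + i′  ∎)
      where open ≤-Reasoning

  _≼?_ : ∀ w x → Dec (w ≼ x)
  w ≼? x = map′ (λ (_ , eq) → depth x ∸ depth w , m∸n≤m (depth x) (depth w) , eq)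
                (λ w≼x@(i , _ , eq) → ≼⇒depth≤ w≼x , subst (λ k → up k x ≡ w) (height w≼x) eq)
                (depth w ≤? depth x ×-dec up (depth x ∸ depth w) x ≟ w)
    where
    height : ((i , _) : w ≼ x) → i ≡ depth x ∸ depth w
    height w≼x@(i , _) = trans (sym (m+n∸m≡n (depth w) i)) (cong (_∸ depth w) (≼-depth w≼x))

  walk-start : ∀ {A x z} → WalkIn T A x z → A x ≡ true
  walk-start (here Ax)     = Ax
  walk-start (step Ax _ _) = Ax

  -- A walk leaving the subtree of w does so through the edge from w to its parent.
  exit : ∀ {A w x z} → WalkIn T A x z → w ≼ x → ¬ w ≼ z → A w ≡ true × 0 < depth w × A (parent w) ≡ true
  exit (here _) w≼x w⋠z = contradiction w≼x w⋠z
  exit {A} {w} (step {x = x} {y = x′} Ax e rest) w≼x w⋠z with w ≼? x′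
  ... | yes w≼x′ = exit rest w≼x′ w⋠z
  ... | no  w⋠x′ with edge-parent-or-child e
  ...   | inj₁ (px′≡x , 1+dx≡dx′) =
    contradiction (≼-trans w≼x (subst (_≼ x′) px′≡x (parent≼ (subst (0 <_) 1+dx≡dx′ (s≤s z≤n))))) w⋠x′
  ...   | inj₂ (px≡x′ , 1+dx′≡dx) with w ≟ x
  ...     | no  w≢x  = contradiction (subst (w ≼_) px≡x′ (≼-parent w≼x w≢x)) w⋠x′
  ...     | yes refl = Ax , subst (0 <_) 1+dx′≡dx (s≤s z≤n) , subst (λ v → A v ≡ true) (sym px≡x′) (walk-start rest)

  module ConnectedSubtree (A : Fin n → Bool) (nonEmpty : NonEmpty T A) (connected : ConnectedSet T A) where

    In : Pred (Fin n) 0ℓ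
    In v = A v ≡ true

    in? : Decidable In
    in? v = A v Bool.≟ true

    Occupied : Pred ℕ 0ℓ
    Occupied k = ∃ λ v → In v × depth v ≡ k

    occupied? : Decidable Occupied
    occupied? k = any? (λ v → in? v ×-dec depth v ℕ.≟ k)

    opaque
      top-data : ∃ (Least occupied?)
      top-data = least occupied? (proj₁ nonEmpty , proj₂ nonEmpty , refl)

    top : Fin n
    top = proj₁ (proj₁ (proj₂ top-data))

    top-in : In top
    top-in = proj₁ (proj₂ (proj₁ (proj₂ top-data)))

    top-highest : ∀ {v} → In v → depth top ≤ depth v
    top-highest {v} v∈A = subst (_≤ depth v) (sym (proj₂ (proj₂ (proj₁ (proj₂ top-data)))))
      (least-≤ occupied? (proj₂ top-data) (v , v∈A , refl))

    parent-top-out : 0 < depth top → ¬ In (parent top)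
    parent-top-out 0<d p∈A =
      <⇒≱ (subst (depth (parent top) <_) (proj₁ (parent-spec 0<d)) (n<1+n _)) (top-highest p∈A)

    top-≼ : ∀ {v} → In v → top ≼ v
    top-≼ {v} v∈A = decidable-stable (top ≼? v) λ top⋠v →
      let _ , 0<d , p∈A = exit (connected top v top-in v∈A) ≼-refl top⋠v in parent-top-out 0<d p∈A

    parent-in : ∀ {v} → In v → v ≢ top → 0 < depth v × In (parent v)
    parent-in {v} v∈A v≢top = proj₂ (exit (connected v top v∈A top-in) ≼-refl v⋠top)
      where
      v⋠top : ¬ v ≼ top
      v⋠top v≼top = v≢top (≼-level v≼top (top-highest v∈A))

    Boundary : Pred (Fin n) 0ℓ
    Boundary c = ¬ In c × 0 < depth c × In (parent c)

    boundary? : Decidable Boundary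
    boundary? c = ¬? (in? c) ×-dec 0 <? depth c ×-dec in? (parent c)

    top<boundary : ∀ {c} → Boundary c → depth top < depth c
    top<boundary (_ , 0<d , p∈A) = subst (_ <_) (proj₁ (parent-spec 0<d)) (s≤s (top-highest p∈A))

    below-boundary-outside : ∀ {c z} → Boundary c → c ≼ z → ¬ In z
    below-boundary-outside {c} {z} c∈∂A@(c∉A , _) c≼z z∈A =
      c∉A (proj₁ (exit (connected z top z∈A top-in) c≼z c⋠top))
      where
      c⋠top : ¬ c ≼ top
      c⋠top c≼top = <⇒≱ (top<boundary c∈∂A) (≼⇒depth≤ c≼top)

    boundary-disjoint : ∀ {c c′ x} → Boundary c → Boundary c′ → c ≼ x → c′ ≼ x → c ≡ c′
    boundary-disjoint {c} {c′} c∈∂A c′∈∂A c≼x c′≼x with ≤-total (depth c′) (depth c)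
    ... | inj₁ dc′≤dc = sym (decidable-stable (c′ ≟ c) λ c′≢c → below-boundary-outside c′∈∂A
                              (≼-parent (≼-chain c≼x c′≼x dc′≤dc) c′≢c) (proj₂ (proj₂ c∈∂A)))
    ... | inj₂ dc≤dc′ = decidable-stable (c ≟ c′) λ c≢c′ → below-boundary-outside c∈∂A
                          (≼-parent (≼-chain c′≼x c≼x dc≤dc′) c≢c′) (proj₂ (proj₂ c′∈∂A))

    boundary-below-top : ∀ {c x} → Boundary c → c ≼ x → top ≼ x × x ≢ top
    boundary-below-top c∈∂A@(_ , 0<d , p∈A) c≼x =
      ≼-trans (≼-trans (top-≼ p∈A) (parent≼ 0<d)) c≼x ,
      λ { refl → <⇒≱ (top<boundary c∈∂A) (≼⇒depth≤ c≼x) }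

module Labelling {m : ℕ} {mul : Op₂ (Fin m)} {ε : Fin m} {inv : Op₁ (Fin m)}
  (isAbelianGroup : IsAbelianGroup _≡_ mul ε inv)
  (S : SubadditiveRanking.RankedSubgroup isAbelianGroup)
  {n : ℕ} (T : Graph n) (tree : IsTree T)
  (n<size : n < SubadditiveRanking.RankedSubgroup.size S) where
  open import Algebra.Bundles using (AbelianGroup)
  open import Data.Bool using (Bool)
  open import Data.Fin using (_≟_)
  open import Data.Fin.Properties using (any?)
  open import Data.Nat using (_+_; _≤_; _<?_; z≤n)
  open import Data.Nat.Properties using (≤-trans; ≤-<-trans; ≤-reflexive; <⇒≱; n<1+n; module ≤-Reasoning)
  open import Data.Product using (∃; _×_; _,_; proj₁; proj₂)
  open import Data.Sum using (_⊎_; inj₁; inj₂)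
  open import Function using (_∘_; mk⇔)
  open import Level using (0ℓ)
  open import Relation.Binary.PropositionalEquality using (_≢_; refl; sym; trans; cong; module ≡-Reasoning)
  open import Relation.Nullary using (¬_; Dec; yes; no; ¬?)
  open import Relation.Nullary.Decidable using (_×-dec_)
  open import Relation.Unary using (Pred; Decidable)

  open SubadditiveRanking isAbelianGroup using (abelianGroup; rank-∑⟨⟩)
  open SubadditiveRanking.RankedSubgroup S
  open AbelianGroup abelianGroup using (_∙_; _-_; comm; identityˡ; commutativeMonoid)
  open import Algebra.Properties.AbelianGroup abelianGroup using (//-rightDividesˡ; ∙-cancelˡ)
  open RootedTree T tree

  module GΣ = FilteredSum commutativeMonoid
  module ℕΣ = NatSum
  open GΣ using (∑⟨_⟩)

  subtree-size : Fin n → ℕ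
  subtree-size v = ℕΣ.count (v ≼?_)

  element-of-rank : ∀ v → ∃ λ x → K x × rank x ≡ subtree-size v
  element-of-rank v = rank-surjective (≤-<-trans (ℕΣ.count≤ (v ≼?_)) n<size)

  y : Fin n → Fin m
  y v = proj₁ (element-of-rank v)

  K-y : ∀ v → K (y v)
  K-y v = proj₁ (proj₂ (element-of-rank v))

  rank-y : ∀ v → rank (y v) ≡ subtree-size v
  rank-y v = proj₂ (proj₂ (element-of-rank v))

  Child : Fin n → Pred (Fin n) 0ℓ
  Child v c = 0 < depth c × parent c ≡ v

  child? : ∀ v → Decidable (Child v)
  child? v c = 0 <? depth c ×-dec parent c ≟ v

  children-sum : Fin n → Fin m
  children-sum v = ∑⟨ child? v ⟩ y

  label : Fin n → Fin m
  label v = y v - children-sum v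

  module _ (A : Fin n → Bool) (nonEmpty : NonEmpty T A) (connected : ConnectedSet T A) where
    open ConnectedSubtree A nonEmpty connected

    HasParentIn : Pred (Fin n) 0ℓ
    HasParentIn c = 0 < depth c × In (parent c)

    hasParentIn? : Decidable HasParentIn
    hasParentIn? c = 0 <? depth c ×-dec in? (parent c)

    Inner : Pred (Fin n) 0ℓ
    Inner c = In c × c ≢ top

    inner? : Decidable Inner
    inner? c = in? c ×-dec ¬? (c ≟ top)

    StrictlyBelowTop : Pred (Fin n) 0ℓ
    StrictlyBelowTop x = top ≼ x × x ≢ top

    strictly-below-top? : Decidable StrictlyBelowTop
    strictly-below-top? x = top ≼? x ×-dec ¬? (x ≟ top)

    ∑-label : ∑⟨ in? ⟩ label ∙ ∑⟨ in? ⟩ children-sum ≡ ∑⟨ in? ⟩ y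
    ∑-label = trans (sym (GΣ.∑⟨⟩-distrib in? label children-sum))
                    (GΣ.∑⟨⟩-cong in? (λ v _ → //-rightDividesˡ (children-sum v) (y v)))

    ∑-children : ∑⟨ in? ⟩ children-sum ≡ ∑⟨ hasParentIn? ⟩ y
    ∑-children = trans (GΣ.∑⟨⟩-swap in? child? y) (GΣ.sum-cong-≋ λ c →
      trans (GΣ.∑⟨⟩-subsingleton (λ v → in? v ×-dec child? v c) (λ _ → y c) (parent c) (λ _ (_ , _ , eq) → sym eq))
            (GΣ.select-⇔ (in? (parent c) ×-dec child? (parent c) c) (hasParentIn? c)
                         (mk⇔ (λ (p∈A , 0<d , _) → 0<d , p∈A) (λ (0<d , p∈A) → p∈A , 0<d , refl)) (y c)))

    ∑-in : ∑⟨ in? ⟩ y ≡ y top ∙ ∑⟨ inner? ⟩ y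
    ∑-in = GΣ.∑⟨⟩-remove in? top-in y

    ∑-hasParentIn : ∑⟨ hasParentIn? ⟩ y ≡ ∑⟨ inner? ⟩ y ∙ ∑⟨ boundary? ⟩ y
    ∑-hasParentIn = GΣ.∑⟨⟩-split hasParentIn? inner? boundary? (λ c → mk⇔ (to c) from)
                                 (λ c (c∈A , _) (c∉A , _) → c∉A c∈A) y
      where
      to : ∀ c → HasParentIn c → Inner c ⊎ Boundary c
      to c (0<d , p∈A) with in? c
      ... | yes c∈A = inj₁ (c∈A , λ { refl → parent-top-out 0<d p∈A })
      ... | no  c∉A = inj₂ (c∉A , 0<d , p∈A)
      from : ∀ {c} → Inner c ⊎ Boundary c → HasParentIn c
      from (inj₁ (c∈A , c≢top))  = parent-in c∈A c≢top
      from (inj₂ (_ , 0<d , p∈A)) = 0<d , p∈A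

    boundary-sum : ∑⟨ in? ⟩ label ≡ ε → ∑⟨ boundary? ⟩ y ≡ y top
    boundary-sum ∑≡ε = ∙-cancelˡ (∑⟨ inner? ⟩ y) (∑⟨ boundary? ⟩ y) (y top) (begin
      ∑⟨ inner? ⟩ y ∙ ∑⟨ boundary? ⟩ y                  ≡⟨ sym ∑-hasParentIn ⟩
      ∑⟨ hasParentIn? ⟩ y                               ≡⟨ sym ∑-children ⟩
      ∑⟨ in? ⟩ children-sum                  ≡⟨ sym (identityˡ (∑⟨ in? ⟩ children-sum)) ⟩
      ε ∙ ∑⟨ in? ⟩ children-sum              ≡⟨ cong (_∙ ∑⟨ in? ⟩ children-sum) (sym ∑≡ε) ⟩
      ∑⟨ in? ⟩ label ∙ ∑⟨ in? ⟩ children-sum ≡⟨ ∑-label ⟩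
      ∑⟨ in? ⟩ y                                        ≡⟨ ∑-in ⟩
      y top ∙ ∑⟨ inner? ⟩ y                             ≡⟨ comm (y top) (∑⟨ inner? ⟩ y) ⟩
      ∑⟨ inner? ⟩ y ∙ y top                             ∎)
      where open ≡-Reasoning

    BoundaryAbove : Fin n → Pred (Fin n) 0ℓ
    BoundaryAbove x c = Boundary c × c ≼ x

    boundary-above? : ∀ x → Decidable (BoundaryAbove x)
    boundary-above? x c = boundary? c ×-dec c ≼? x

    boundaries-above : ∀ x → ℕΣ.count (boundary-above? x) ≤ ℕΣ.select (strictly-below-top? x) 1
    boundaries-above x = by-cases (any? (boundary-above? x))
      where
      by-cases : Dec (∃ (BoundaryAbove x)) → ℕΣ.count (boundary-above? x) ≤ ℕΣ.select (strictly-below-top? x) 1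
      by-cases (no ∄) =
        ≤-trans (≤-reflexive (ℕΣ.∑⟨⟩-none (boundary-above? x) (λ _ → 1) (λ c b → ∄ (c , b)))) z≤n
      by-cases (yes (c , c∈∂A , c≼x)) = begin
        ℕΣ.count (boundary-above? x)            ≡⟨ ℕΣ.∑⟨⟩-subsingleton (boundary-above? x) (λ _ → 1) c only-c ⟩
        ℕΣ.select (boundary-above? x c) 1       ≡⟨ ℕΣ.select-yes (boundary-above? x c) (c∈∂A , c≼x) 1 ⟩
        1                                       ≡⟨ sym (ℕΣ.select-yes (strictly-below-top? x) below-top 1) ⟩
        ℕΣ.select (strictly-below-top? x) 1     ∎
        where
        open ≤-Reasoning
        only-c : ∀ c′ → BoundaryAbove x c′ → c′ ≡ c
        only-c c′ (c′∈∂A , c′≼x) = boundary-disjoint c′∈∂A c∈∂A c′≼x c≼x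
        below-top = boundary-below-top c∈∂A c≼x

    boundary-size< : ℕΣ.∑⟨ boundary? ⟩ subtree-size < subtree-size top
    boundary-size< = begin-strict
      ℕΣ.∑⟨ boundary? ⟩ subtree-size
        ≡⟨ ℕΣ.∑⟨⟩-swap boundary? _≼?_ (λ _ → 1) ⟩
      ℕΣ.sum (λ x → ℕΣ.count (boundary-above? x))
        ≤⟨ ℕΣ.∑-mono-≤ boundaries-above ⟩
      ℕΣ.count strictly-below-top?
        <⟨ n<1+n _ ⟩
      1 + ℕΣ.count strictly-below-top?
        ≡⟨ sym (ℕΣ.∑⟨⟩-remove (top ≼?_) ≼-refl (λ _ → 1)) ⟩
      subtree-size top ∎
      where open ≤-Reasoning

    zero-avoiding : ¬ ∑⟨ in? ⟩ label ≡ ε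
    zero-avoiding ∑≡ε = <⇒≱ boundary-size< (begin
      subtree-size top                   ≡⟨ sym (rank-y top) ⟩
      rank (y top)                       ≡⟨ cong rank (sym (boundary-sum ∑≡ε)) ⟩
      rank (∑⟨ boundary? ⟩ y)            ≤⟨ proj₂ (rank-∑⟨⟩ S boundary? y (λ c _ → K-y c)) ⟩
      ℕΣ.∑⟨ boundary? ⟩ (rank ∘ y)       ≡⟨ ℕΣ.∑⟨⟩-cong boundary? (λ c _ → rank-y c) ⟩
      ℕΣ.∑⟨ boundary? ⟩ subtree-size     ∎)
      where open ≤-Reasoning

-- The group law of 𝒢 transported along enum to Fin order, where equality is ≡ and decidable.
module Indexing {c ℓ} (𝒢 : FiniteAbelianGroup c ℓ) where
  open import Algebra.Bundles using (RawGroup; AbelianGroup)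
  open import Algebra.Morphism.Structures using (IsGroupMonomorphism)
  open import Algebra.Structures using (IsAbelianGroup)
  open import Data.Bool using (Bool; true; false; if_then_else_)
  import Data.Bool.Properties as Bool
  open import Data.Fin using (Fin; zero; suc)
  open import Data.Nat using (zero; suc)
  open import Data.Product using (proj₁; proj₂)
  open import Level using (0ℓ)
  open import Relation.Binary.PropositionalEquality as ≡ using (_≡_)

  open FiniteAbelianGroup 𝒢
  import Algebra.Morphism.GroupMonomorphism as GroupMonomorphism

  index : Carrier → Fin order
  index g = proj₁ (enum-surj g)

  enum-index : ∀ g → enum (index g) ≈ g
  enum-index g = proj₂ (enum-surj g)

  indexRawGroup : RawGroup 0ℓ 0ℓ
  indexRawGroup = record
    { Carrier = Fin order
    ; _≈_     = _≡_
    ; _∙_     = λ i j → index (enum i ∙ enum j)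
    ; ε       = index ε
    ; _⁻¹     = λ i → index (enum i ⁻¹)
    }

  enum-isGroupMonomorphism : IsGroupMonomorphism indexRawGroup rawGroup enum
  enum-isGroupMonomorphism = record
    { isGroupHomomorphism = record
      { isMonoidHomomorphism = record
        { isMagmaHomomorphism = record
          { isRelHomomorphism = record { cong = λ { ≡.refl → refl } }
          ; homo              = λ i j → enum-index (enum i ∙ enum j)
          }
        ; ε-homo = enum-index ε
        }
      ; ⁻¹-homo = λ i → enum-index (enum i ⁻¹)
      }
    ; injective = enum-inj _ _
    }

  open RawGroup indexRawGroup public using () renaming (_∙_ to _⊕_; ε to 0ᶠ; _⁻¹ to ⊖_)

  index-isAbelianGroup : IsAbelianGroup _≡_ _⊕_ 0ᶠ ⊖_
  index-isAbelianGroup = GroupMonomorphism.isAbelianGroup enum-isGroupMonomorphism isAbelianGroup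

  indexAbelianGroup : AbelianGroup 0ℓ 0ℓ
  indexAbelianGroup = record { isAbelianGroup = index-isAbelianGroup }

  open FilteredSum (AbelianGroup.commutativeMonoid indexAbelianGroup) using (∑⟨_⟩; select)

  labelSum-enum : ∀ {n} (A : Fin n → Bool) (f : Fin n → Fin order) →
                  labelSum 𝒢 A (λ v → enum (f v)) ≈ enum (∑⟨ (λ v → A v Bool.≟ true) ⟩ f)
  labelSum-enum {zero}  A f = sym (enum-index ε)
  labelSum-enum {suc n} A f =
    trans (∙-cong (head-≈ (A zero)) (labelSum-enum (λ v → A (suc v)) (λ v → f (suc v)))) (sym (enum-index _))
    where
    head-≈ : ∀ b → (if b then enum (f zero) else ε) ≈ enum (select (b Bool.≟ true) (f zero))
    head-≈ true  = refl
    head-≈ false = sym (enum-index ε)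

module _ {c ℓ} (𝒢 : FiniteAbelianGroup c ℓ) where
  open FiniteAbelianGroup 𝒢
  open Indexing 𝒢
  open SubadditiveRanking using (ranked-subgroup-beyond)

  zero-avoiding-labelling : ∀ {n} (T : Graph n) → IsTree T → n < order → Σ (Fin n → Carrier) (ZeroAvoiding 𝒢 T)
  zero-avoiding-labelling T tree n<order
    with S , n<size ← ranked-subgroup-beyond index-isAbelianGroup n<order =
    enum ∘ label , λ A nonEmpty connected ∑≈ε → zero-avoiding A nonEmpty connected
      (enum-inj _ _ (trans (sym (labelSum-enum A label)) (trans ∑≈ε (sym (enum-index ε)))))
    where open Labelling index-isAbelianGroup S T tree n<size

proposition4p3 : ∀ {c ℓ : Level} (𝒢 : FiniteAbelianGroup c ℓ) (n : ℕ) (T : Graph n)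
  → IsTree T → n < FiniteAbelianGroup.order 𝒢 → ¬ ZeroForcing 𝒢 T
proposition4p3 𝒢 n T tree n<order zero-forcing = zero-forcing (zero-avoiding-labelling 𝒢 T tree n<order)
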